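{- Let $\xi$ be an address, $n\in\mathbb N$, $\mathfrak E,\mathfrak F\in\mathbb L_n$, let $\mathfrak q$ be a path of both $\mathfrak E$ and $\mathfrak F$, and let $\kappa$ be an action such that $\mathfrak q\kappa$ is a path of $\mathfrak E$ but not a path of $\mathfrak F$. Then $\kappa$ is positive.
   Context: Ludics: actions are $(+,\xi,I)$, $(-,\xi,I)$ (address a finite sequence of naturals, $I$ finite set of naturals) or the positive daimon $\maltese$; an action on $\xi.i$ is justified by an action of opposite polarity on $\xi$ whose ramification contains $i$; an action is initial if its address is in the base. Chronicles: nonempty finite alternating sequences on a base, each proper action initial or justified by an earlier one (non-initial negative ones by the immediately preceding action), distinct addresses, $\maltese$ only last; designs: prefix-closed coherent sets of chronicles. View: $\ulcorner\epsilon\urcorner=\epsilon$, $\ulcorner\kappa\urcorner=\kappa$, $\ulcorner w\kappa^+\urcorner=\ulcorner w\urcorner\kappa^+$, $\ulcorner w\kappa^-\urcorner=\ulcorner w_0\urcorner\kappa^-$ where $w_0$ is empty if $\kappa^-$ is initial and otherwise the prefix of $w$ ending with the positive action justifying $\kappa^-$. A path on a base is a finite alternating sequence of actions in which every proper action is initial or justified by an earlier action, every positive proper action justified by a negative action $\kappa'$ has $\kappa'$ in the view of the preceding prefix (and initial positive actions satisfy Girard–Fouqueré–Quatrini's positional conditions), addresses are pairwise distinct, $\maltese$ only last, and for a positive base the path is nonempty and starts with $\maltese$ or a positive action on the base. A path $\mathfrak p$ is a path of a design $\mathfrak D$ if it is a path and the views of all its nonempty prefixes are chronicles of $\mathfrak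 D$. Lists: $\mathbf 0_\tau=\{(+,\tau,\emptyset)\}$, $(\mathbf{k+1})_\tau$ the prefix closure of $\{(+,\tau,\{0\})(-,\tau.0,\{1\})\mathfrak c\mid\mathfrak c\in\mathbf k_{\tau.0.1}\}$; $\mathfrak D^{\epsilon}_\xi=\{(+,\xi,\emptyset)\}$, and for $n>0$, $\mathfrak D^{\langle a_1,\dots,a_n\rangle}_\xi$ is the prefix closure of $\{(+,\xi,\{0,1\})(-,\xi.0,\{1\})\mathfrak c\mid\mathfrak c\in(\mathbf a_1)_{\xi.0.1}\}\cup\{(+,\xi,\{0,1\})(-,\xi.1,\{1\})\mathfrak c\mid\mathfrak c\in\mathfrak D^{\langle a_2,\dots,a_n\rangle}_{\xi.1.1}\}$; $\mathbb L_n=\{\mathfrak D^{\langle a_1,\dots,a_n\rangle}_\xi\mid a_i\in\mathbb N\}$. -}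

module Defs where

open import Data.Nat using (ℕ; zero; suc; _<_; z≤n; s≤s)
open import Data.List using (List; []; _∷_; _++_; _∷ʳ_; reverse; mapMaybe; [_])
open import Data.List.Membership.Propositional using (_∈_)
open import Data.List.Relation.Unary.AllPairs using (AllPairs; []; _∷_)
open import Data.List.Relation.Unary.All using ([]; _∷_)
open import Data.List.Relation.Unary.Any using (Any)
open import Data.Maybe using (Maybe; just; nothing)
open import Data.Vec using (Vec; toList)
open import Data.Product using (Σ; ∃; _×_; _,_)
open import Data.Sum using (_⊎_)
open import Data.Bool using (Bool; true; false; if_then_else_)
open import Relation.Binary.PropositionalEquality using (_≡_; _≢_; refl)
open import Relation.Nullary using (¬_; Dec; yes; no)
open import Relation.Nullary.Decidable using (⌊_⌋)
open import Data.List.Membership.DecPropositional (Data.Nat._≟_) using (_∈?_)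
open import Data.List.Properties using (≡-dec)
import Data.Nat
open import Data.Empty using (⊥)
open import Data.Unit using (⊤)

Address : Set
Address = List ℕ

_∙_ : Address → ℕ → Address
ξ ∙ i = ξ ∷ʳ i

-- Finite sets of naturals, canonically as strictly increasing lists
-- (the sortedness proof is irrelevant, so equal element lists give
-- definitionally equal sets).
record FinSet : Set where
  constructor mkFinSet
  field
    elems   : List ℕ
    .sorted : AllPairs _<_ elems
open FinSet public

_∈ₛ_ : ℕ → FinSet → Set
i ∈ₛ I = i ∈ elems I

∅ₛ : FinSet
∅ₛ = mkFinSet [] []

｛0｝ : FinSet
｛0｝ = mkFinSet (0 ∷ []) ([] ∷ [])

｛1｝ : FinSet
｛1｝ = mkFinSet (1 ∷ []) ([] ∷ [])

｛0,1｝ : FinSet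
｛0,1｝ = mkFinSet (0 ∷ 1 ∷ []) ((s≤s z≤n ∷ []) ∷ [] ∷ [])

data Polarity : Set where
  pos neg : Polarity

data Action : Set where
  act    : Polarity → Address → FinSet → Action
  daimon : Action

polarity : Action → Polarity
polarity (act p _ _) = p
polarity daimon      = pos

Positive : Action → Set
Positive κ = polarity κ ≡ pos

Proper : Action → Set
Proper (act _ _ _) = ⊤
Proper daimon      = ⊥

address? : Action → Maybe Address
address? (act _ ζ _) = just ζ
address? daimon      = nothing

data Justifies : Action → Action → Set where
  just-by : ∀ {p p' ζ i I J} → p' ≢ p → i ∈ₛ I →
            Justifies (act p' ζ I) (act p (ζ ∙ i) J)

polEq : Polarity → Polarity → Bool
polEq pos pos = true
polEq neg neg = true
polEq _   _   = false

justifiesᵇ : Action → Action → Bool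
justifiesᵇ (act p' ζ I) (act p α J) = go α
  where
    go : Address → Bool
    go α with reverse α
    ... | [] = false
    ... | i ∷ rζ = if polEq p p' then false
                   else (if ⌊ ≡-dec Data.Nat._≟_ (reverse rζ) ζ ⌋
                         then ⌊ i ∈? elems I ⌋ else false)
justifiesᵇ _ _ = false

-- Designs on the positive base ⊢ ξ are sets of chronicles (predicates).

Design : Set₁
Design = List Action → Set

Initial : Address → Action → Set
Initial ξ (act _ ζ _) = ζ ≡ ξ
Initial ξ daimon      = ⊥

initialᵇ : Address → Action → Bool
initialᵇ ξ (act _ ζ _) = ⌊ ≡-dec Data.Nat._≟_ ζ ξ ⌋
initialᵇ ξ daimon      = false

-- Computed on reversed sequences (most recent action first):
--   ⌜w κ⁺⌝ = ⌜w⌝ κ⁺ ;  ⌜w κ⁻⌝ = ⌜w₀⌝ κ⁻ with w₀ empty if κ⁻ is initial,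
--   otherwise the prefix of w ending with the action justifying κ⁻.
--   (If no justifier exists — impossible in paths — w₀ is taken empty.)

mutual
  rview : Address → List Action → List Action
  rview ξ []      = []
  rview ξ (κ ∷ w) with polarity κ
  ... | pos = κ ∷ rview ξ w
  ... | neg = if initialᵇ ξ κ then κ ∷ [] else κ ∷ rviewFrom ξ κ w

  rviewFrom : Address → Action → List Action → List Action
  rviewFrom ξ κ []      = []
  rviewFrom ξ κ (a ∷ w) = if justifiesᵇ a κ then rview ξ (a ∷ w) else rviewFrom ξ κ w

view : Address → List Action → List Action
view ξ w = reverse (rview ξ (reverse w))

record IsPath (ξ : Address) (p : List Action) : Set where
  field
    start       : (Σ (List Action) λ v → p ≡ daimon ∷ v)
                ⊎ (Σ FinSet λ I → Σ (List Action) λ v → p ≡ act pos ξ I ∷ v)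
    alternating : ∀ u a b v → p ≡ u ++ a ∷ b ∷ v → polarity a ≢ polarity b
    justified   : ∀ u κ v → p ≡ u ++ κ ∷ v → Proper κ →
                  Initial ξ κ ⊎ Any (λ κ' → Justifies κ' κ) u
    inView      : ∀ u κ v κ' → p ≡ u ++ κ ∷ v → polarity κ ≡ pos → κ' ∈ u →
                  Justifies κ' κ → κ' ∈ view ξ u
    distinct    : AllPairs _≢_ (mapMaybe address? p)
    daimonLast  : ∀ u v → p ≡ u ++ daimon ∷ v → v ≡ []

PathOf : Address → Design → List Action → Set
PathOf ξ D p = IsPath ξ p × (∀ u v → p ≡ u ++ v → u ≢ [] → D (view ξ u))

PrefixClosure : Design → Design
PrefixClosure S c = c ≢ [] × Σ (List Action) λ d → S d × Σ (List Action) λ v → d ≡ c ++ v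

NatD : ℕ → Address → Design
NatD zero    τ c = c ≡ act pos τ ∅ₛ ∷ []
NatD (suc k) τ   = PrefixClosure λ c →
  Σ (List Action) λ c' → NatD k ((τ ∙ 0) ∙ 1) c' ×
    c ≡ act pos τ ｛0｝ ∷ act neg (τ ∙ 0) ｛1｝ ∷ c'

ListD : List ℕ → Address → Design
ListD []       ξ c = c ≡ act pos ξ ∅ₛ ∷ []
ListD (a ∷ as) ξ   = PrefixClosure λ c →
    (Σ (List Action) λ c' → NatD a ((ξ ∙ 0) ∙ 1) c' ×
       c ≡ act pos ξ ｛0,1｝ ∷ act neg (ξ ∙ 0) ｛1｝ ∷ c')
  ⊎ (Σ (List Action) λ c' → ListD as ((ξ ∙ 1) ∙ 1) c' ×
       c ≡ act pos ξ ｛0,1｝ ∷ act neg (ξ ∙ 1) ｛1｝ ∷ c')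

Lₙ : ∀ {n} → Vec ℕ n → Address → Design
Lₙ as ξ = ListD (toList as) ξ

-- Lists in ludics are "negatively deterministic": a negative action that
-- extends a path of one list design 𝔈 ∈ 𝕃ₙ also extends every path of
-- another 𝔉 ∈ 𝕃ₙ.  Hence an action separating a common path of 𝔈 and 𝔉
-- must be positive.
--
-- The view of q κ⁻ is c κ⁻ with c empty or the view of a
--     nonempty prefix of q; so if D' has the transfer property with respect
--     to D, is prefix-closed and nonempty, every path of D' extended by a
--     negative κ which gives a path of D is a path of D'.
module Submission where

open import Defs
open import Data.Nat using (ℕ; zero; suc)
open import Data.Vec using (Vec; toList)
open import Data.List using (List; _∷ʳ_; []; _∷_; _++_; reverse)
open import Data.List.Properties
  using (++-assoc; ++-identityʳ; ++-conicalˡ; ++-conicalʳ; ∷-injective; ∷ʳ-injectiveʳ; reverse-++; reverse-involutive; unfold-reverse)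
open import Data.Product using (Σ; _×_; _,_; proj₁; proj₂)
open import Data.Sum using (_⊎_; inj₁; inj₂)
open import Data.Bool using (true; false)
open import Data.Empty using (⊥-elim)
open import Function using (_∘_)
open import Relation.Nullary using (¬_)
open import Relation.Binary.PropositionalEquality
  using (_≡_; _≢_; refl; sym; trans; cong; subst; module ≡-Reasoning)

Negative : Action → Set
Negative κ = polarity κ ≡ neg

pos≢neg : pos ≢ neg
pos≢neg ()

snoc≢[] : ∀ (c : List Action) κ → c ∷ʳ κ ≢ []
snoc≢[] c κ eq with ++-conicalʳ c (κ ∷ []) eq
... | ()

prefixesOfSnoc : ∀ (q : List Action) κ u v → q ∷ʳ κ ≡ u ++ v →
                 u ≡ q ∷ʳ κ ⊎ Σ (List Action) λ v' → q ≡ u ++ v'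
prefixesOfSnoc q       κ []          v eq = inj₂ (q , refl)
prefixesOfSnoc []      κ (x ∷ [])    v eq = inj₁ (cong (_∷ []) (sym (proj₁ (∷-injective eq))))
prefixesOfSnoc []      κ (x ∷ y ∷ u) v ()
prefixesOfSnoc (z ∷ q) κ (x ∷ u)     v eq with ∷-injective eq
... | refl , eq' with prefixesOfSnoc q κ u v eq'
...   | inj₁ e        = inj₁ (cong (z ∷_) e)
...   | inj₂ (v' , e) = inj₂ (v' , cong (z ∷_) e)

PrefixIn : Design → List Action → Set
PrefixIn D c = Σ (List Action) λ e → D e × Σ (List Action) λ v → e ≡ c ++ v

Inhabited : Design → Set
Inhabited D = Σ (List Action) D

PrefixClosed : Design → Set
PrefixClosed D = ∀ {c} → c ≢ [] → PrefixIn D c → D c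

chronicleIsPrefix : ∀ {D c} → D c → PrefixIn D c
chronicleIsPrefix {c = c} d = c , d , [] , sym (++-identityʳ c)

emptyPrefix : ∀ {D} → Inhabited D → PrefixIn D []
emptyPrefix (e , d) = e , d , e , refl

closureElim : ∀ {S c} → PrefixIn (PrefixClosure S) c → PrefixIn S c
closureElim {c = c} (e , (_ , e' , Se' , v' , eq') , v , eq) =
  e' , Se' , v ++ v' , trans eq' (trans (cong (_++ v') eq) (++-assoc c v v'))

closurePrefixClosed : ∀ {S} → PrefixClosed (PrefixClosure S)
closurePrefixClosed ne p = ne , closureElim p

closureInhabited : ∀ {S c} → c ≢ [] → S c → Inhabited (PrefixClosure S)
closureInhabited {c = c} ne d = c , ne , chronicleIsPrefix d

Step : Action → Action → Design → Design
Step x y D c = Σ (List Action) λ c' → D c' × c ≡ x ∷ y ∷ c'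

stepPrefix : ∀ {x y D w w' c} → PrefixIn (Step x y D) (w ∷ w' ∷ c) →
             w ≡ x × w' ≡ y × PrefixIn D c
stepPrefix (_ , (c' , d , refl) , v , refl) = refl , refl , (c' , d , v , refl)

stepPrefixIntro : ∀ {x y D c} → PrefixIn D c → PrefixIn (Step x y D) (x ∷ y ∷ c)
stepPrefixIntro (e , d , v , eq) = _ , (e , d , refl) , v , cong (λ z → _ ∷ _ ∷ z) eq

stepNegShape : ∀ {x y D c κ} → Positive x → Negative κ → PrefixIn (Step x y D) (c ∷ʳ κ) →
               (c ≡ x ∷ [] × κ ≡ y)
             ⊎ Σ (List Action) λ c' → c ≡ x ∷ y ∷ c' × PrefixIn D (c' ∷ʳ κ)
stepNegShape {c = []}         x⁺ κ⁻ (_ , (_ , _ , refl) , _ , refl) = ⊥-elim (pos≢neg (trans (sym x⁺) κ⁻))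
stepNegShape {c = _ ∷ []}     x⁺ κ⁻ (_ , (_ , _ , refl) , _ , refl) = inj₁ (refl , refl)
stepNegShape {c = _ ∷ _ ∷ c'} x⁺ κ⁻ (_ , (_ , d , refl) , v , refl) = inj₂ (c' , refl , (_ , d , v , refl))

stepNegStart : ∀ {x y D c κ} → Positive x → Negative κ → PrefixIn (Step x y D) (c ∷ʳ κ) →
               Σ (List Action) λ c' → c ≡ x ∷ c'
stepNegStart x⁺ κ⁻ p with stepNegShape x⁺ κ⁻ p
... | inj₁ (refl , _)       = [] , refl
... | inj₂ (c' , refl , _)  = _ , refl

-- Union of designs; the list designs are prefix closures of unions of two
-- Steps, one for the head integer and one for the tail.
_∪_ : Design → Design → Design
(A ∪ B) c = A c ⊎ B c

unionPrefix : ∀ {A B c} → PrefixIn (A ∪ B) c → PrefixIn A c ⊎ PrefixIn B c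
unionPrefix (e , inj₁ a , v , eq) = inj₁ (e , a , v , eq)
unionPrefix (e , inj₂ b , v , eq) = inj₂ (e , b , v , eq)

unionLeft : ∀ {A B c} → PrefixIn A c → PrefixIn (A ∪ B) c
unionLeft (e , a , v , eq) = e , inj₁ a , v , eq

unionRight : ∀ {A B c} → PrefixIn B c → PrefixIn (A ∪ B) c
unionRight (e , b , v , eq) = e , inj₂ b , v , eq

Single : Action → Design
Single z c = c ≡ z ∷ []

singleFirst : ∀ {z x c} → PrefixIn (Single z) (x ∷ c) → x ≡ z
singleFirst (_ , refl , _ , eq) = sym (proj₁ (∷-injective eq))

singleNoNegative : ∀ {z c κ} → Positive z → Negative κ → ¬ PrefixIn (Single z) (c ∷ʳ κ)
singleNoNegative {c = []}    z⁺ κ⁻ (_ , refl , _ , eq) =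
  pos≢neg (trans (sym z⁺) (trans (cong polarity (proj₁ (∷-injective eq))) κ⁻))
singleNoNegative {c = _ ∷ c} {κ} z⁺ κ⁻ (_ , refl , v , eq) =
  snoc≢[] c κ (++-conicalˡ (c ∷ʳ κ) v (sym (proj₂ (∷-injective eq))))

singlePrefixClosed : ∀ {z} → PrefixClosed (Single z)
singlePrefixClosed {c = []}    ne _ = ⊥-elim (ne refl)
singlePrefixClosed {c = x ∷ c} ne (_ , refl , v , eq)
  with refl , tail ← ∷-injective eq
  rewrite ++-conicalˡ c v (sym tail) = refl

NegTransfer : Design → Design → Set
NegTransfer D D' = ∀ c κ → Negative κ → PrefixIn D (c ∷ʳ κ) → PrefixIn D' c → PrefixIn D' (c ∷ʳ κ)

closureNegTransfer : ∀ {S S'} → NegTransfer S S' → NegTransfer (PrefixClosure S) (PrefixClosure S')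
closureNegTransfer transfer c κ κ⁻ pE pF =
  chronicleIsPrefix (snoc≢[] c κ , transfer c κ κ⁻ (closureElim pE) (closureElim pF))

-- The second action y is available in D' as soon as D' is nonempty; the
-- rest is transferred inside D.
stepNegTransfer : ∀ {x y D D'} → Positive x → Inhabited D' → NegTransfer D D' →
                  NegTransfer (Step x y D) (Step x y D')
stepNegTransfer x⁺ inhabited transfer c κ κ⁻ pE pF with stepNegShape x⁺ κ⁻ pE
... | inj₁ (refl , refl)     = stepPrefixIntro (emptyPrefix inhabited)
... | inj₂ (c' , refl , eE)  = stepPrefixIntro (transfer c' κ κ⁻ eE (proj₂ (proj₂ (stepPrefix pF))))

-- If c κ⁻ is a prefix in the y-branch and c one in a different y'-branch,
-- then c is just the common first action and κ⁻ = y.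
crossBranch : ∀ {x y y' D D' D''} {c κ} → Positive x → y ≢ y' → Inhabited D' → Negative κ →
              PrefixIn (Step x y D) (c ∷ʳ κ) → PrefixIn (Step x y' D'') c →
              PrefixIn (Step x y D') (c ∷ʳ κ)
crossBranch x⁺ y≢y' inhabited κ⁻ pE pF with stepNegShape x⁺ κ⁻ pE
... | inj₁ (refl , refl)    = stepPrefixIntro (emptyPrefix inhabited)
... | inj₂ (c' , refl , _)  = ⊥-elim (y≢y' (proj₁ (proj₂ (stepPrefix pF))))

-- Transfer for a positive action followed by two distinct negative branches,
-- the shape of a nonempty list design.
forkNegTransfer : ∀ {x y₀ y₁ D₀ D₁ D₀' D₁'} → Positive x → y₀ ≢ y₁ →
                  Inhabited D₀' → Inhabited D₁' → NegTransfer D₀ D₀' → NegTransfer D₁ D₁' →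
                  NegTransfer (Step x y₀ D₀ ∪ Step x y₁ D₁) (Step x y₀ D₀' ∪ Step x y₁ D₁')
forkNegTransfer x⁺ y₀≢y₁ inh₀ inh₁ transfer₀ transfer₁ c κ κ⁻ pE pF
  with unionPrefix pE | unionPrefix pF
... | inj₁ e | inj₁ f = unionLeft  (stepNegTransfer x⁺ inh₀ transfer₀ c κ κ⁻ e f)
... | inj₂ e | inj₂ f = unionRight (stepNegTransfer x⁺ inh₁ transfer₁ c κ κ⁻ e f)
... | inj₁ e | inj₂ f = unionLeft  (crossBranch x⁺ y₀≢y₁ inh₀ κ⁻ e f)
... | inj₂ e | inj₁ f = unionRight (crossBranch x⁺ (y₀≢y₁ ∘ sym) inh₁ κ⁻ e f)

forkNegStart : ∀ {x y₀ y₁ D₀ D₁ c κ} → Positive x → Negative κ →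
               PrefixIn (Step x y₀ D₀ ∪ Step x y₁ D₁) (c ∷ʳ κ) → Σ (List Action) λ c' → c ≡ x ∷ c'
forkNegStart x⁺ κ⁻ p with unionPrefix p
... | inj₁ e = stepNegStart x⁺ κ⁻ e
... | inj₂ e = stepNegStart x⁺ κ⁻ e

natInhabited : ∀ k τ → Inhabited (NatD k τ)
natInhabited zero    τ = _ , refl
natInhabited (suc k) τ with natInhabited k ((τ ∙ 0) ∙ 1)
... | c , d = closureInhabited (λ ()) (c , d , refl)

listInhabited : ∀ as τ → Inhabited (ListD as τ)
listInhabited []       τ = _ , refl
listInhabited (a ∷ as) τ with natInhabited a ((τ ∙ 0) ∙ 1)
... | c , d = closureInhabited (λ ()) (inj₁ (c , d , refl))

listPrefixClosed : ∀ as τ → PrefixClosed (ListD as τ)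
listPrefixClosed []       τ = singlePrefixClosed
listPrefixClosed (a ∷ as) τ = closurePrefixClosed

-- Transfer between any two integer designs on the same address: a negative
-- extension in 0 is impossible, and k+1 vs 0 differ on the first action.
natNegTransfer : ∀ a b τ → NegTransfer (NatD a τ) (NatD b τ)
natNegTransfer zero    b       τ c κ κ⁻ pE pF = ⊥-elim (singleNoNegative refl κ⁻ pE)
natNegTransfer (suc a) zero    τ c κ κ⁻ pE pF with stepNegStart refl κ⁻ (closureElim pE)
... | _ , refl with singleFirst pF
... | ()
natNegTransfer (suc a) (suc b) τ =
  closureNegTransfer (stepNegTransfer refl (natInhabited b _) (natNegTransfer a b _))

addressEq : ∀ {p p' ζ ζ' I I'} → act p ζ I ≡ act p' ζ' I' → ζ ≡ ζ'
addressEq refl = refl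

branchesDiffer : ∀ ξ → act neg (ξ ∙ 0) ｛1｝ ≢ act neg (ξ ∙ 1) ｛1｝
branchesDiffer ξ eq with ∷ʳ-injectiveʳ ξ ξ (addressEq eq)
... | ()

listNegTransfer : ∀ as bs τ → NegTransfer (ListD as τ) (ListD bs τ)
listNegTransfer []       bs       τ c κ κ⁻ pE pF = ⊥-elim (singleNoNegative refl κ⁻ pE)
listNegTransfer (a ∷ as) []       τ c κ κ⁻ pE pF with forkNegStart refl κ⁻ (closureElim pE)
... | _ , refl with singleFirst pF
... | ()
listNegTransfer (a ∷ as) (b ∷ bs) τ =
  closureNegTransfer (forkNegTransfer refl (branchesDiffer τ)
    (natInhabited b _) (listInhabited bs _) (natNegTransfer a b _) (listNegTransfer as bs _))

data ViewTail (ξ : Address) (q c : List Action) : Set where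
  initial   : c ≡ [] → ViewTail ξ q c
  justified : ∀ p s → q ≡ p ++ s → p ≢ [] → c ≡ view ξ p → ViewTail ξ q c

viewTailExtend : ∀ {ξ q c} r → ViewTail ξ q c → ViewTail ξ (q ++ r) c
viewTailExtend r (initial e)                = initial e
viewTailExtend r (justified p s refl ne e)  = justified p (s ++ r) (++-assoc p s r) ne e

-- rviewFrom looks, in the reversed history w, for the justifier of κ and
-- takes the view up to it; un-reversed this is a ViewTail.
rviewFromTail : ∀ ξ κ w → ViewTail ξ (reverse w) (reverse (rviewFrom ξ κ w))
rviewFromTail ξ κ []      = initial refl
rviewFromTail ξ κ (a ∷ w) with justifiesᵇ a κ
... | true  = justified (reverse (a ∷ w)) [] (sym (++-identityʳ _)) nonEmpty
                (cong (reverse ∘ rview ξ) (sym (reverse-involutive (a ∷ w))))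
  where
  nonEmpty : reverse (a ∷ w) ≢ []
  nonEmpty eq = snoc≢[] (reverse w) a (trans (sym (unfold-reverse a w)) eq)
... | false = subst (λ q → ViewTail ξ q _) (sym (unfold-reverse a w))
                (viewTailExtend (a ∷ []) (rviewFromTail ξ κ w))

rviewNegative : ∀ ξ ζ I w → Σ (List Action) λ R →
                rview ξ (act neg ζ I ∷ w) ≡ act neg ζ I ∷ R × ViewTail ξ (reverse w) (reverse R)
rviewNegative ξ ζ I w with initialᵇ ξ (act neg ζ I)
... | true  = [] , refl , initial refl
... | false = rviewFrom ξ (act neg ζ I) w , refl , rviewFromTail ξ (act neg ζ I) w

viewOfNegative : ∀ ξ q κ → Negative κ → Σ (List Action) λ c →
                 view ξ (q ∷ʳ κ) ≡ c ∷ʳ κ × ViewTail ξ q c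
viewOfNegative ξ q (act neg ζ I) refl with rviewNegative ξ ζ I (reverse q)
... | R , eq , tail = reverse R , viewEq , subst (λ q → ViewTail ξ q _) (reverse-involutive q) tail
  where
  open ≡-Reasoning
  κ = act neg ζ I
  viewEq : view ξ (q ∷ʳ κ) ≡ reverse R ∷ʳ κ
  viewEq = begin
    reverse (rview ξ (reverse (q ∷ʳ κ)))  ≡⟨ cong (reverse ∘ rview ξ) (reverse-++ q (κ ∷ [])) ⟩
    reverse (rview ξ (κ ∷ reverse q))     ≡⟨ cong reverse eq ⟩
    reverse (κ ∷ R)                       ≡⟨ unfold-reverse κ R ⟩
    reverse R ∷ʳ κ                        ∎

viewTailPrefix : ∀ {ξ D q c} → PathOf ξ D q → Inhabited D → ViewTail ξ q c → PrefixIn D c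
viewTailPrefix path inhabited (initial refl)            = emptyPrefix inhabited
viewTailPrefix path inhabited (justified p s eq ne refl) = chronicleIsPrefix (proj₂ path p s eq ne)

negativeExtension : ∀ {ξ D D' q κ} → NegTransfer D D' → PrefixClosed D' → Inhabited D' →
                    PathOf ξ D' q → PathOf ξ D (q ∷ʳ κ) → Negative κ → PathOf ξ D' (q ∷ʳ κ)
negativeExtension {ξ} {D} {D'} {q} {κ} transfer closed inhabited pathD' pathD κ⁻ =
  proj₁ pathD , viewsInD'
  where
  c = proj₁ (viewOfNegative ξ q κ κ⁻)
  viewEq = proj₁ (proj₂ (viewOfNegative ξ q κ κ⁻))
  tail = proj₂ (proj₂ (viewOfNegative ξ q κ κ⁻))

  lastViewInD : PrefixIn D (c ∷ʳ κ)
  lastViewInD = subst (PrefixIn D) viewEq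
    (chronicleIsPrefix (proj₂ pathD (q ∷ʳ κ) [] (sym (++-identityʳ _)) (snoc≢[] q κ)))

  lastViewInD' : D' (view ξ (q ∷ʳ κ))
  lastViewInD' = subst D' (sym viewEq)
    (closed (snoc≢[] c κ) (transfer c κ κ⁻ lastViewInD (viewTailPrefix pathD' inhabited tail)))

  viewsInD' : ∀ u v → q ∷ʳ κ ≡ u ++ v → u ≢ [] → D' (view ξ u)
  viewsInD' u v eq ne with prefixesOfSnoc q κ u v eq
  ... | inj₁ refl       = lastViewInD'
  ... | inj₂ (v' , eq') = proj₂ pathD' u v' eq' ne

mainTheorem15 : (ξ : Address) (n : ℕ) (as bs : Vec ℕ n)
    (q : List Action) (κ : Action) →
    PathOf ξ (Lₙ as ξ) q → PathOf ξ (Lₙ bs ξ) q →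
    PathOf ξ (Lₙ as ξ) (q ∷ʳ κ) → ¬ PathOf ξ (Lₙ bs ξ) (q ∷ʳ κ) →
    Positive κ
mainTheorem15 ξ n as bs q κ _ pathF pathE notPathF with polarity κ in κ-polarity
... | pos = refl
... | neg = ⊥-elim (notPathF (negativeExtension
              (listNegTransfer (toList as) (toList bs) ξ)
              (listPrefixClosed (toList bs) ξ) (listInhabited (toList bs) ξ)
              pathF pathE κ-polarity))
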